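{- Let $s\ge 1$ and let $(G,k)$ be an instance of Edge Triangle $s$-Club with $\ell=1$ in which every edge of $G$ is contained in at least one triangle of $G$. If $|N_{\lfloor s/2\rfloor}[v]|\ge k$ for some vertex $v\in V(G)$, then $(G,k)$ is a yes-instance.
   Context: A vertex set $S$ of a graph $G$ fulfills the edge-$\ell$-triangle property (for given $s$) if $G[S]$ contains a spanning subgraph $G'=(S,E')$ such that every edge of $E'$ is contained in at least $\ell$ triangles of $G'$ and the diameter of $G'$ is at most $s$. Edge Triangle $s$-Club: given $G$ and integers $k,\ell\ge 1$, decide whether $G$ contains a vertex set $S$ with $|S|\ge k$ fulfilling the edge-$\ell$-triangle property. $N_i[v]$ denotes the set of vertices at distance at most $i$ from $v$ in $G$. -}

module Defs where

open import Data.Nat using (ℕ; zero; suc; _≤_)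
open import Data.Bool using (Bool; true; false; _∧_; _∨_)
open import Data.Fin using (Fin)
open import Data.Fin.Properties using (_≟_)
open import Data.Fin.Subset using (Subset; _∈_)
open import Data.List using (List; length; filterᵇ; allFin)
open import Data.Bool.ListAction using (any)
open import Data.Vec using (tabulate)
open import Data.Product using (Σ; _×_)
open import Relation.Binary.PropositionalEquality using (_≡_)
open import Relation.Nullary.Decidable using (⌊_⌋)

Rel₂ : ℕ → Set
Rel₂ n = Fin n → Fin n → Bool

record Graph (n : ℕ) : Set where
  field
    Adj    : Rel₂ n
    sym    : ∀ u v → Adj u v ≡ Adj v u
    irrefl : ∀ u → Adj u u ≡ false
open Graph public

Within : ∀ {n} → Rel₂ n → ℕ → Fin n → Fin n → Bool
Within E zero    u v = ⌊ u ≟ v ⌋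
Within E (suc i) u v = Within E i u v ∨ any (λ w → Within E i u w ∧ E w v) (allFin _)

Ball : ∀ {n} → Graph n → ℕ → Fin n → Subset n
Ball G i v = tabulate (λ u → Within (Adj G) i v u)

triangles : ∀ {n} → Rel₂ n → Fin n → Fin n → ℕ
triangles E u v = length (filterᵇ (λ w → E u w ∧ E v w) (allFin _))

-- S fulfills the edge-ℓ-triangle property (for s): G[S] has a spanning
-- subgraph G' = (S, E') in which every edge lies in ≥ ℓ triangles of G'
-- and whose diameter is at most s.
EdgeTriangleProperty : ∀ {n} → Graph n → ℕ → ℕ → Subset n → Set
EdgeTriangleProperty {n} G s ℓ S =
  Σ (Rel₂ n) λ E' →
    (∀ u v → E' u v ≡ E' v u) ×
    (∀ u v → E' u v ≡ true → (u ∈ S) × (v ∈ S) × (Adj G u v ≡ true)) ×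
    (∀ u v → E' u v ≡ true → ℓ ≤ triangles E' u v) ×
    (∀ u v → u ∈ S → v ∈ S → Within E' s u v ≡ true)

-- Take S = N_r[v] with r = ⌊s/2⌋, and keep exactly those edges of G[S] that lie in a
-- triangle of G[S]; every kept edge then lies in a triangle of kept edges. A walk of
-- length ≤ r from v survives: each of its edges wu lies in a triangle wux of G, and x,
-- being adjacent to w, is itself within distance r of v. Hence every vertex of S is
-- within r of v in the kept graph, whose diameter is therefore at most 2r ≤ s.
module Submission where

open import Defs
open import Data.Nat using (ℕ; zero; suc; _+_; _≤_; _≤′_; ≤′-refl; ≤′-step; ⌊_/2⌋)
open import Data.Nat.Properties using (≤-trans; ≤-refl; ≤-reflexive; n≤1+n; +-monoʳ-≤; ≤⇒≤′; ⌊n/2⌋≤⌈n/2⌉; ⌊n/2⌋+⌈n/2⌉≡n)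
open import Data.Bool using (Bool; true; false; _∧_; _∨_)
open import Data.Bool.Properties using (T-≡; ∨-zeroʳ; ⇔→≡)
open import Data.Bool.ListAction using (any)
open import Data.Fin using (Fin)
open import Data.Fin.Properties using (_≟_)
open import Data.Fin.Subset using (Subset; ∣_∣; _∈_)
open import Data.List using (List; _∷_; length; filterᵇ; allFin)
open import Data.List.Relation.Unary.Any using (here; satisfied)
open import Data.List.Relation.Unary.Any.Properties using (any⁺; any⁻)
open import Data.List.Membership.Propositional using (lose) renaming (_∈_ to _∈ₗ_)
open import Data.List.Membership.Propositional.Properties using (∈-allFin; ∈-filter⁺; ∈-filter⁻; ∈-length)
open import Data.Vec.Properties using (lookup⇒[]=; []=⇒lookup; lookup∘tabulate)
open import Data.Product using (Σ; ∃; _×_; _,_; proj₂)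
open import Function using (_∘_; Equivalence; mk⇔)
open import Relation.Nullary using (yes; no; contradiction)
open import Relation.Binary.PropositionalEquality using (_≡_; refl; trans; cong; cong₂) renaming (sym to sym≡)

private
  variable
    n : ℕ

∧-intro : ∀ {a b} → a ≡ true → b ≡ true → a ∧ b ≡ true
∧-intro = cong₂ _∧_

∧-elim : ∀ a {b} → a ∧ b ≡ true → a ≡ true × b ≡ true
∧-elim true b≡true = refl , b≡true

∨-introˡ : ∀ {a} b → a ≡ true → a ∨ b ≡ true
∨-introˡ b a≡true = cong (_∨ b) a≡true

∨-introʳ : ∀ a {b} → b ≡ true → a ∨ b ≡ true
∨-introʳ a b≡true = trans (cong (a ∨_) b≡true) (∨-zeroʳ a)

any-intro : {A : Set} (p : A → Bool) {x : A} {xs : List A} → x ∈ₗ xs → p x ≡ true → any p xs ≡ true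
any-intro p x∈ px = Equivalence.to T-≡ (any⁺ p (lose x∈ (Equivalence.from T-≡ px)))

any-witness : {A : Set} (p : A → Bool) (xs : List A) → any p xs ≡ true → ∃ λ x → p x ≡ true
any-witness p xs any≡true with x , px ← satisfied (any⁻ p xs (Equivalence.from T-≡ any≡true)) =
  x , Equivalence.to T-≡ px

nonempty-member : {A : Set} (xs : List A) → 1 ≤ length xs → ∃ λ x → x ∈ₗ xs
nonempty-member (x ∷ _) _ = x , here refl

filterᵇ-nonempty : {A : Set} (p : A → Bool) {x : A} {xs : List A} →
                   x ∈ₗ xs → p x ≡ true → 1 ≤ length (filterᵇ p xs)
filterᵇ-nonempty p x∈ px = ∈-length (∈-filter⁺ _ x∈ (Equivalence.from T-≡ px))

filterᵇ-witness : {A : Set} (p : A → Bool) (xs : List A) → 1 ≤ length (filterᵇ p xs) → ∃ λ x → p x ≡ true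
filterᵇ-witness p xs nonempty with x , x∈ ← nonempty-member _ nonempty =
  x , Equivalence.to T-≡ (proj₂ (∈-filter⁻ _ {xs = xs} x∈))

data Walk≤ (E : Rel₂ n) : ℕ → Fin n → Fin n → Set where
  stay  : ∀ {u} → Walk≤ E zero u u
  relax : ∀ {i u v} → Walk≤ E i u v → Walk≤ E (suc i) u v
  step  : ∀ {i u w v} → Walk≤ E i u w → E w v ≡ true → Walk≤ E (suc i) u v

module _ {E : Rel₂ n} where

  Within⇒Walk≤ : ∀ i u v → Within E i u v ≡ true → Walk≤ E i u v
  Within⇒Walk≤ zero u v within with u ≟ v
  ... | yes refl = stay
  Within⇒Walk≤ (suc i) u v within with Within E i u v in shorter
  ... | true  = relax (Within⇒Walk≤ i u v shorter)
  ... | false with w , uw∧wv ← any-witness (λ w → Within E i u w ∧ E w v) (allFin n) within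
                 with uw , wv ← ∧-elim (Within E i u w) uw∧wv =
    step (Within⇒Walk≤ i u w uw) wv

  Walk≤⇒Within : ∀ {i u v} → Walk≤ E i u v → Within E i u v ≡ true
  Walk≤⇒Within {u = u} stay with u ≟ u
  ... | yes _   = refl
  ... | no u≢u = contradiction refl u≢u
  Walk≤⇒Within {suc i} {u} {v} (relax p) =
    ∨-introˡ (any (λ w → Within E i u w ∧ E w v) (allFin n)) (Walk≤⇒Within p)
  Walk≤⇒Within {suc i} {u} {v} (step {w = w} p wv) =
    ∨-introʳ (Within E i u v)
      (any-intro (λ w → Within E i u w ∧ E w v) (∈-allFin w) (∧-intro (Walk≤⇒Within p) wv))

  Walk≤-mono : ∀ {i j u v} → i ≤ j → Walk≤ E i u v → Walk≤ E j u v
  Walk≤-mono = Walk≤-mono′ ∘ ≤⇒≤′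
    where
      Walk≤-mono′ : ∀ {i j u v} → i ≤′ j → Walk≤ E i u v → Walk≤ E j u v
      Walk≤-mono′ ≤′-refl        p = p
      Walk≤-mono′ (≤′-step i≤′j) p = relax (Walk≤-mono′ i≤′j p)

  Walk≤-++ : ∀ {i j u w v} → Walk≤ E i u w → Walk≤ E j w v → Walk≤ E (j + i) u v
  Walk≤-++ p stay        = p
  Walk≤-++ p (relax q)   = relax (Walk≤-++ p q)
  Walk≤-++ p (step q wv) = step (Walk≤-++ p q) wv

  module _ (E-sym : ∀ u v → E u v ≡ E v u) where

    Walk≤-cons : ∀ {i u w v} → E u w ≡ true → Walk≤ E i w v → Walk≤ E (suc i) u v
    Walk≤-cons uw stay         = step stay uw
    Walk≤-cons uw (relax q)    = relax (Walk≤-cons uw q)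
    Walk≤-cons uw (step q w′v) = step (Walk≤-cons uw q) w′v

    Walk≤-reverse : ∀ {i u v} → Walk≤ E i u v → Walk≤ E i v u
    Walk≤-reverse stay                      = stay
    Walk≤-reverse (relax p)                 = relax (Walk≤-reverse p)
    Walk≤-reverse (step {w = w} {v = v} p wv) = Walk≤-cons (trans (E-sym v w) wv) (Walk≤-reverse p)

module TriangleCore (G : Graph n) (S : Fin n → Bool) where

  private
    A = Adj G

  Apex : Fin n → Fin n → Fin n → Bool
  Apex u w x = S x ∧ (A u x ∧ A w x)

  Core : Rel₂ n
  Core u w = S u ∧ (S w ∧ (A u w ∧ any (Apex u w) (allFin n)))

  Core-intro : ∀ {u w x} → S u ≡ true → S w ≡ true → A u w ≡ true →
               S x ≡ true → A u x ≡ true → A w x ≡ true → Core u w ≡ true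
  Core-intro {u} {w} {x} su sw uw sx ux wx =
    ∧-intro su (∧-intro sw (∧-intro uw (any-intro (Apex u w) (∈-allFin x) (∧-intro sx (∧-intro ux wx)))))

  Core-elim : ∀ {u w} → Core u w ≡ true →
              S u ≡ true × S w ≡ true × A u w ≡ true ×
              ∃ λ x → S x ≡ true × A u x ≡ true × A w x ≡ true
  Core-elim {u} {w} core =
    let su , core₁     = ∧-elim (S u) core
        sw , core₂     = ∧-elim (S w) core₁
        uw , apex      = ∧-elim (A u w) core₂
        x , x-apex     = any-witness (Apex u w) (allFin n) apex
        sx , ux∧wx     = ∧-elim (S x) x-apex
        ux , wx        = ∧-elim (A u x) ux∧wx
    in su , sw , uw , x , sx , ux , wx

  Core-flip : ∀ {u w} → Core u w ≡ true → Core w u ≡ true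
  Core-flip core with su , sw , uw , x , sx , ux , wx ← Core-elim core =
    Core-intro sw su (trans (sym G _ _) uw) sx wx ux

  Core-sym : ∀ u w → Core u w ≡ Core w u
  Core-sym u w = ⇔→≡ (mk⇔ Core-flip Core-flip)

  Core-triangle : ∀ {u w} → Core u w ≡ true → 1 ≤ triangles Core u w
  Core-triangle {u} {w} core with su , sw , uw , x , sx , ux , wx ← Core-elim core =
    filterᵇ-nonempty (λ y → Core u y ∧ Core w y) (∈-allFin x)
      (∧-intro (Core-intro su sx ux sw uw (trans (sym G x w) wx))
               (Core-intro sw sx wx su (trans (sym G w u) uw) (trans (sym G x u) ux)))

⌊n/2⌋+⌊n/2⌋≤n : ∀ m → ⌊ m /2⌋ + ⌊ m /2⌋ ≤ m
⌊n/2⌋+⌊n/2⌋≤n m = ≤-trans (+-monoʳ-≤ ⌊ m /2⌋ (⌊n/2⌋≤⌈n/2⌉ m)) (≤-reflexive (⌊n/2⌋+⌈n/2⌉≡n m))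

∈Ball⇒Within : ∀ (G : Graph n) r v u → u ∈ Ball G r v → Within (Adj G) r v u ≡ true
∈Ball⇒Within G r v u u∈ = trans (sym≡ (lookup∘tabulate (Within (Adj G) r v) u)) ([]=⇒lookup u∈)

Within⇒∈Ball : ∀ (G : Graph n) r v u → Within (Adj G) r v u ≡ true → u ∈ Ball G r v
Within⇒∈Ball G r v u within = lookup⇒[]= u (Ball G r v) (trans (lookup∘tabulate (Within (Adj G) r v) u) within)

module BallCore (G : Graph n) (r : ℕ) (v : Fin n)
                (edges-in-triangles : ∀ u w → Adj G u w ≡ true → 1 ≤ triangles (Adj G) u w) where

  open TriangleCore G (Within (Adj G) r v) public

  private
    A = Adj G

    inBall : ∀ {i u} → i ≤ r → Walk≤ A i v u → Within A r v u ≡ true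
    inBall i≤r p = Walk≤⇒Within (Walk≤-mono i≤r p)

  Walk≤-lift : ∀ {i u} → i ≤ r → Walk≤ A i v u → Walk≤ Core i v u
  Walk≤-lift i≤r stay      = stay
  Walk≤-lift i≤r (relax p) = relax (Walk≤-lift (≤-trans (n≤1+n _) i≤r) p)
  Walk≤-lift i≤r (step {w = w} {v = u} p wu)
    with x , wx∧ux ← filterᵇ-witness (λ x → A w x ∧ A u x) (allFin n) (edges-in-triangles w u wu)
    with wx , ux ← ∧-elim (A w x) wx∧ux =
    step (Walk≤-lift i-1≤r p)
         (Core-intro (inBall i-1≤r p) (inBall i≤r (step p wu)) wu (inBall i≤r (step p wx)) wx ux)
    where
      i-1≤r = ≤-trans (n≤1+n _) i≤r

  Core-radius : ∀ u → u ∈ Ball G r v → Walk≤ Core r v u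
  Core-radius u u∈ = Walk≤-lift ≤-refl (Within⇒Walk≤ r v u (∈Ball⇒Within G r v u u∈))

  Core-⊆ : ∀ u w → Core u w ≡ true → (u ∈ Ball G r v) × (w ∈ Ball G r v) × (A u w ≡ true)
  Core-⊆ u w core with su , sw , uw , _ ← Core-elim core =
    Within⇒∈Ball G r v u su , Within⇒∈Ball G r v w sw , uw

  Core-diameter : ∀ u w → u ∈ Ball G r v → w ∈ Ball G r v → Walk≤ Core (r + r) u w
  Core-diameter u w u∈ w∈ = Walk≤-++ (Walk≤-reverse Core-sym (Core-radius u u∈)) (Core-radius w w∈)

lemma7 : ∀ {n} (G : Graph n) (s k : ℕ) → 1 ≤ s → 1 ≤ k →
    (∀ u v → Adj G u v ≡ true → 1 ≤ triangles (Adj G) u v) →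
    (v : Fin n) → k ≤ ∣ Ball G ⌊ s /2⌋ v ∣ →
    Σ (Subset n) λ S → (k ≤ ∣ S ∣) × EdgeTriangleProperty G s 1 S
lemma7 G s k _ _ edges-in-triangles v k≤∣ball∣ =
  Ball G r v , k≤∣ball∣ , Core , Core-sym , Core-⊆ , (λ _ _ → Core-triangle) , diameter
  where
    r = ⌊ s /2⌋
    open BallCore G r v edges-in-triangles

    diameter : ∀ u w → u ∈ Ball G r v → w ∈ Ball G r v → Within Core s u w ≡ true
    diameter u w u∈ w∈ = Walk≤⇒Within (Walk≤-mono (⌊n/2⌋+⌊n/2⌋≤n s) (Core-diameter u w u∈ w∈))
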